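{- Let $\epsilon$ be a positive integer and let $G=\langle\alpha,\beta\rangle$ be the group of bijections of $\mathbb{Q}_+^5$ generated by $$\alpha(a,b,c,d,e)=\Big(b,\tfrac{b^2+cd}{a},c,d,e\Big),\qquad \beta(a,b,c,d,e)=\Big(b,c,\tfrac{ac+be}{d},a,e\Big).$$ Then for every $g\in G$, the vector $g(\epsilon,\epsilon,\epsilon,\epsilon,\epsilon)$ has the form $(a,b,c,d,\epsilon)$ with $a,b,c,d,\epsilon$ positive integers, and every component of $g(\epsilon,\epsilon,\epsilon,\epsilon,\epsilon)$ is divisible by $\epsilon$. In other words, $$G(\epsilon,\epsilon,\epsilon,\epsilon,\epsilon)\subseteq\{P=(a,b,c,d,\epsilon)\in\mathbb{N}^5 \mid P\equiv 0 \pmod{\epsilon}\}.$$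
   Context: $\mathbb{N}$ denotes the positive integers and $\mathbb{Q}_+$ the positive rationals. For a group $H$ acting on a set and a point $x$, $H(x)=\{h(x)\mid h\in H\}$ is its orbit. For a vector $P=(x_1,\dots,x_n)$, $P\equiv 0\pmod{\epsilon}$ means $x_i\equiv 0\pmod{\epsilon}$ for all $i$. The maps $\alpha,\beta$ are invertible, with $\alpha^{ -1}(a,b,c,d,e)=(\frac{a^2+cd}{b},a,c,d,e)$ and $\beta^{ -1}(a,b,c,d,e)=(d,a,b,\frac{ae+bd}{c},e)$. -}

module Defs where

open import Data.Nat as ℕ using (ℕ)
open import Data.Integer using (+_)
open import Data.Rational using (ℚ; _+_; _*_; _÷_; 0ℚ; ≢-nonZero; _/_)
open import Data.Rational.Properties using (_≟_)
open import Data.Product using (_×_; _,_)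
open import Data.List using (List; []; _∷_)
open import Relation.Nullary using (yes; no)

Q5 : Set
Q5 = ℚ × ℚ × ℚ × ℚ × ℚ

-- Total division: x / y for y ≠ 0, and 0 otherwise.  On ℚ_+^5 all
-- denominators below are positive, so this agrees with the paper's maps.
_⊘_ : ℚ → ℚ → ℚ
x ⊘ y with y ≟ 0ℚ
... | yes _ = 0ℚ
... | no y≢0 = _÷_ x y {{≢-nonZero y≢0}}

α : Q5 → Q5
α (a , b , c , d , e) = (b , ((b * b) + (c * d)) ⊘ a , c , d , e)

β : Q5 → Q5
β (a , b , c , d , e) = (b , c , ((a * c) + (b * e)) ⊘ d , a , e)

α⁻¹ : Q5 → Q5
α⁻¹ (a , b , c , d , e) = (((a * a) + (c * d)) ⊘ b , a , c , d , e)

β⁻¹ : Q5 → Q5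
β⁻¹ (a , b , c , d , e) = (d , a , b , ((a * e) + (b * d)) ⊘ c , e)

data Gen : Set where
  `α `β `α⁻¹ `β⁻¹ : Gen

gen : Gen → Q5 → Q5
gen `α   = α
gen `β   = β
gen `α⁻¹ = α⁻¹
gen `β⁻¹ = β⁻¹

-- Every element of G is the action of some word in the generators and
-- their inverses; act (g₁ ∷ … ∷ gₖ) = g₁ ∘ … ∘ gₖ.
act : List Gen → Q5 → Q5
act []      P = P
act (g ∷ w) P = gen g (act w P)

ι : ℕ → ℚ
ι n = + n / 1

diag : ℕ → Q5
diag n = (ι n , ι n , ι n , ι n , ι n)

-- Both maps are homogeneous of degree one, so on points (εa, εb, εc, εd, ε) they
-- act as ε times the maps
--   (a, b, c, d) ↦ (b, (b² + cd)/a, c, d)   and   (a, b, c, d) ↦ (b, c, (ac + b)/d, a).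
-- These keep (1, 1, 1, 1) integral because they preserve the invariant
--   a ∣ b² + cd,  b ∣ a² + cd,  d ∣ ac + b,  c ∣ a + bd,  a, b, c, d pairwise coprime:
-- multiplying each new numerator by a coordinate coprime to its divisor turns it
-- into a combination of old ones.  The swap (a, b, c, d) ↦ (b, a, d, c) preserves
-- the invariant and conjugates α to α⁻¹ and β to β⁻¹.
module Submission where

open import Defs
open import Data.Nat using (ℕ; suc; _+_; _*_; _≤_; _<_; z<s; >-nonZero; >-nonZero⁻¹)
open import Data.Nat.Properties using (*-comm; +-comm; *-identityʳ; m*n≢0⇒n≢0; m≤m+n; m≤n+m; ≤-trans)
open import Data.Nat.Divisibility using (_∣_; divides; ∣m∣n⇒∣m+n; ∣m+n∣m⇒∣n; n∣m*n; m∣m*n; ∣m⇒∣m*n; ∣n⇒∣m*n; ∣-trans; ∣-refl; 1∣_)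
open import Data.Nat.Coprimality as Coprime using (Coprime; coprime-divisor; 1-coprimeTo)
open import Data.Nat.Tactic.RingSolver using (solve)
open import Data.Integer using (+_)
import Data.Integer.Properties as ℤ
open import Data.Rational as ℚ using (ℚ; mkℚ; 0ℚ; 1ℚ; 1/_; ≢-nonZero)
open import Data.Rational.Properties using (_≟_; normalize-coprime; *-inverseʳ)
import Data.Rational.Properties as ℚ
open import Data.Product using (_×_; _,_; ∃-syntax)
open import Data.List using (List; []; _∷_)
open import Relation.Nullary using (yes; no)
open import Relation.Binary.PropositionalEquality using (_≡_; refl; sym; trans; cong; cong₂; subst; module ≡-Reasoning)

ι≡mkℚ : ∀ n → ι n ≡ mkℚ (+ n) 0 (Coprime.sym (1-coprimeTo n))
ι≡mkℚ n = normalize-coprime (Coprime.sym (1-coprimeTo n))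

ι-homo-+ : ∀ m n → ι m ℚ.+ ι n ≡ ι (m + n)
ι-homo-+ m n rewrite ι≡mkℚ m | ι≡mkℚ n =
  cong (ℚ._/ 1) (cong₂ Data.Integer._+_ (ℤ.*-identityʳ (+ m)) (ℤ.*-identityʳ (+ n)))

ι-homo-* : ∀ m n → ι m ℚ.* ι n ≡ ι (m * n)
ι-homo-* m n rewrite ι≡mkℚ m | ι≡mkℚ n = cong (ℚ._/ 1) (sym (ℤ.pos-* m n))

ι-sum-of-products : ∀ p q r s → ι p ℚ.* ι q ℚ.+ ι r ℚ.* ι s ≡ ι (p * q + r * s)
ι-sum-of-products p q r s = trans (cong₂ ℚ._+_ (ι-homo-* p q) (ι-homo-* r s)) (ι-homo-+ (p * q) (r * s))

ι≡0ℚ⇒≡0 : ∀ {n} → ι n ≡ 0ℚ → n ≡ 0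
ι≡0ℚ⇒≡0 {n} eq = ℤ.+-injective (cong ℚ.numerator (trans (sym (ι≡mkℚ n)) eq))

ι-⊘ : ∀ {m n k} → 0 < n → m ≡ n * k → ι m ⊘ ι n ≡ ι k
ι-⊘ {m} {n} {k} n>0 m≡n*k with ι n ≟ 0ℚ
... | yes ιn≡0 with () ← subst (0 <_) (ι≡0ℚ⇒≡0 ιn≡0) n>0
... | no ιn≢0 = begin
  ι m ℚ.* (1/ ι n)           ≡⟨ cong (λ z → ι z ℚ.* (1/ ι n)) m≡n*k ⟩
  ι (n * k) ℚ.* (1/ ι n)     ≡⟨ cong (λ z → ι z ℚ.* (1/ ι n)) (*-comm n k) ⟩
  ι (k * n) ℚ.* (1/ ι n)     ≡⟨ cong (ℚ._* (1/ ι n)) (sym (ι-homo-* k n)) ⟩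
  ι k ℚ.* ι n ℚ.* (1/ ι n)   ≡⟨ ℚ.*-assoc (ι k) (ι n) (1/ ι n) ⟩
  ι k ℚ.* (ι n ℚ.* (1/ ι n)) ≡⟨ cong (ι k ℚ.*_) (*-inverseʳ (ι n)) ⟩
  ι k ℚ.* 1ℚ                 ≡⟨ ℚ.*-identityʳ (ι k) ⟩
  ι k                        ∎
  where
  open ≡-Reasoning
  instance _ = ≢-nonZero ιn≢0

*-pos : ∀ {m n} → 0 < m → 0 < n → 0 < m * n
*-pos {suc m} {suc n} _ _ = z<s

*-posʳ : ∀ m {n p} → m * n ≡ p → 0 < p → 0 < n
*-posʳ m {n} m*n≡p p>0 = >-nonZero⁻¹ n {{m*n≢0⇒n≢0 m {{>-nonZero (subst (0 <_) (sym m*n≡p) p>0)}}}}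

∣m+n∣n⇒∣m : ∀ {d m n} → d ∣ m + n → d ∣ n → d ∣ m
∣m+n∣n⇒∣m {d} {m} {n} d∣m+n d∣n = ∣m+n∣m⇒∣n (subst (d ∣_) (+-comm m n) d∣m+n) d∣n

coprime-* : ∀ {m n o} → Coprime m n → Coprime m o → Coprime m (n * o)
coprime-* {m} {n} m⊥n m⊥o {k} (k∣m , k∣n*o) = m⊥o (k∣m , coprime-divisor k⊥n k∣n*o)
  where
  k⊥n : Coprime k n
  k⊥n (j∣k , j∣n) = m⊥n (∣-trans j∣k k∣m , j∣n)

coprime-cancel : ∀ {m n o p} → Coprime m n → n * o ≡ p → m ∣ p → m ∣ o
coprime-cancel {m} m⊥n n*o≡p m∣p = coprime-divisor m⊥n (subst (m ∣_) (sym n*o≡p) m∣p)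

record Invariant (a b c d : ℕ) : Set where
  field
    a>0 : 0 < a
    b>0 : 0 < b
    c>0 : 0 < c
    d>0 : 0 < d
    a∣b²+cd : a ∣ b * b + c * d
    b∣a²+cd : b ∣ a * a + c * d
    d∣ac+b : d ∣ a * c + b
    c∣a+bd : c ∣ a + b * d
    a⊥b : Coprime a b
    a⊥c : Coprime a c
    a⊥d : Coprime a d
    b⊥c : Coprime b c
    b⊥d : Coprime b d
    c⊥d : Coprime c d

Invariant-1111 : Invariant 1 1 1 1
Invariant-1111 = record
  { a>0 = z<s ; b>0 = z<s ; c>0 = z<s ; d>0 = z<s
  ; a∣b²+cd = 1∣ _ ; b∣a²+cd = 1∣ _ ; d∣ac+b = 1∣ _ ; c∣a+bd = 1∣ _
  ; a⊥b = 1⊥1 ; a⊥c = 1⊥1 ; a⊥d = 1⊥1 ; b⊥c = 1⊥1 ; b⊥d = 1⊥1 ; c⊥d = 1⊥1 }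
  where
  1⊥1 : Coprime 1 1
  1⊥1 = 1-coprimeTo 1

Invariant-swap : ∀ {a b c d} → Invariant a b c d → Invariant b a d c
Invariant-swap {a} {b} {c} {d} I = record
  { a>0 = b>0 ; b>0 = a>0 ; c>0 = d>0 ; d>0 = c>0
  ; a∣b²+cd = subst (λ z → b ∣ a * a + z) (*-comm c d) b∣a²+cd
  ; b∣a²+cd = subst (λ z → a ∣ b * b + z) (*-comm c d) a∣b²+cd
  ; d∣ac+b = subst (c ∣_) (+-comm a (b * d)) c∣a+bd
  ; c∣a+bd = subst (d ∣_) (+-comm (a * c) b) d∣ac+b
  ; a⊥b = Coprime.sym a⊥b ; a⊥c = b⊥d ; a⊥d = b⊥c ; b⊥c = a⊥d ; b⊥d = a⊥c ; c⊥d = Coprime.sym c⊥d }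
  where open Invariant I

Invariant-α : ∀ {a b c d} → Invariant a b c d → ∀ x → a * x ≡ b * b + c * d → Invariant b x c d
Invariant-α {a} {b} {c} {d} I x ax≡b²+cd = record
  { a>0 = b>0 ; b>0 = x>0 ; c>0 = c>0 ; d>0 = d>0
  ; a∣b²+cd = coprime-cancel (coprime-* (Coprime.sym a⊥b) (Coprime.sym a⊥b)) a²[x²+cd]
      (∣m∣n⇒∣m+n (m∣m*n _) (∣n⇒∣m*n (c * d) b∣a²+cd))
  ; b∣a²+cd = divides a (sym ax≡b²+cd)
  ; d∣ac+b = coprime-cancel (Coprime.sym a⊥d) a[bc+x] (∣m∣n⇒∣m+n (∣n⇒∣m*n b d∣ac+b) (n∣m*n c))
  ; c∣a+bd = coprime-cancel (Coprime.sym a⊥c) a[b+xd] (∣m∣n⇒∣m+n (∣n⇒∣m*n b c∣a+bd) (m∣m*n (d * d)))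
  ; a⊥b = b⊥x ; a⊥c = b⊥c ; a⊥d = b⊥d ; b⊥c = x⊥c ; b⊥d = x⊥d ; c⊥d = c⊥d }
  where
  open Invariant I
  open ≡-Reasoning
  x>0 : 0 < x
  x>0 = *-posʳ a ax≡b²+cd (≤-trans (*-pos b>0 b>0) (m≤m+n _ _))
  a²[x²+cd] : a * a * (x * x + c * d) ≡ b * (b * b * b + 2 * b * c * d) + c * d * (a * a + c * d)
  a²[x²+cd] = begin
    a * a * (x * x + c * d)                             ≡⟨ solve (a ∷ x ∷ c ∷ d ∷ []) ⟩
    (a * x) * (a * x) + c * d * (a * a)                 ≡⟨ cong (λ z → z * z + c * d * (a * a)) ax≡b²+cd ⟩
    (b * b + c * d) * (b * b + c * d) + c * d * (a * a) ≡⟨ solve (a ∷ b ∷ c ∷ d ∷ []) ⟩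
    b * (b * b * b + 2 * b * c * d) + c * d * (a * a + c * d) ∎
  a[bc+x] : a * (b * c + x) ≡ b * (a * c + b) + c * d
  a[bc+x] = begin
    a * (b * c + x)             ≡⟨ solve (a ∷ b ∷ c ∷ x ∷ []) ⟩
    a * b * c + a * x           ≡⟨ cong (λ z → a * b * c + z) ax≡b²+cd ⟩
    a * b * c + (b * b + c * d) ≡⟨ solve (a ∷ b ∷ c ∷ d ∷ []) ⟩
    b * (a * c + b) + c * d     ∎
  a[b+xd] : a * (b + x * d) ≡ b * (a + b * d) + c * (d * d)
  a[b+xd] = begin
    a * (b + x * d)             ≡⟨ solve (a ∷ b ∷ x ∷ d ∷ []) ⟩
    a * b + (a * x) * d         ≡⟨ cong (λ z → a * b + z * d) ax≡b²+cd ⟩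
    a * b + (b * b + c * d) * d ≡⟨ solve (a ∷ b ∷ c ∷ d ∷ []) ⟩
    b * (a + b * d) + c * (d * d)   ∎
  k∣x⇒k∣b²+cd : ∀ {k} → k ∣ x → k ∣ b * b + c * d
  k∣x⇒k∣b²+cd {k} k∣x = subst (k ∣_) ax≡b²+cd (∣n⇒∣m*n a k∣x)
  b⊥x : Coprime b x
  b⊥x (k∣b , k∣x) = coprime-* b⊥c b⊥d (k∣b , ∣m+n∣m⇒∣n (k∣x⇒k∣b²+cd k∣x) (∣m⇒∣m*n b k∣b))
  x⊥c : Coprime x c
  x⊥c (k∣x , k∣c) = coprime-* (Coprime.sym b⊥c) (Coprime.sym b⊥c) (k∣c , ∣m+n∣n⇒∣m (k∣x⇒k∣b²+cd k∣x) (∣m⇒∣m*n d k∣c))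
  x⊥d : Coprime x d
  x⊥d (k∣x , k∣d) = coprime-* (Coprime.sym b⊥d) (Coprime.sym b⊥d) (k∣d , ∣m+n∣n⇒∣m (k∣x⇒k∣b²+cd k∣x) (∣n⇒∣m*n c k∣d))

Invariant-β : ∀ {a b c d} → Invariant a b c d → ∀ y → d * y ≡ a * c + b → Invariant b c y a
Invariant-β {a} {b} {c} {d} I y dy≡ac+b = record
  { a>0 = b>0 ; b>0 = c>0 ; c>0 = y>0 ; d>0 = a>0
  ; a∣b²+cd = coprime-cancel b⊥d d[c²+ya] (∣m∣n⇒∣m+n (∣n⇒∣m*n c b∣a²+cd) (m∣m*n a))
  ; b∣a²+cd = coprime-cancel c⊥d d[b²+ya] (∣m∣n⇒∣m+n (∣n⇒∣m*n b c∣a+bd) (m∣m*n (a * a)))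
  ; d∣ac+b = coprime-cancel a⊥d d[by+c] (∣m∣n⇒∣m+n (m∣m*n (b * c)) a∣b²+cd)
  ; c∣a+bd = divides d (trans (+-comm b (c * a)) (trans (cong (_+ b) (*-comm c a)) (sym dy≡ac+b)))
  ; a⊥b = b⊥c ; a⊥c = b⊥y ; a⊥d = Coprime.sym a⊥b ; b⊥c = c⊥y ; b⊥d = Coprime.sym a⊥c ; c⊥d = y⊥a }
  where
  open Invariant I
  open ≡-Reasoning
  y>0 : 0 < y
  y>0 = *-posʳ d dy≡ac+b (≤-trans b>0 (m≤n+m _ _))
  d[c²+ya] : d * (c * c + y * a) ≡ c * (a * a + c * d) + b * a
  d[c²+ya] = begin
    d * (c * c + y * a)             ≡⟨ solve (d ∷ c ∷ y ∷ a ∷ []) ⟩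
    d * c * c + (d * y) * a         ≡⟨ cong (λ z → d * c * c + z * a) dy≡ac+b ⟩
    d * c * c + (a * c + b) * a     ≡⟨ solve (a ∷ b ∷ c ∷ d ∷ []) ⟩
    c * (a * a + c * d) + b * a     ∎
  d[b²+ya] : d * (b * b + y * a) ≡ b * (a + b * d) + c * (a * a)
  d[b²+ya] = begin
    d * (b * b + y * a)             ≡⟨ solve (d ∷ b ∷ y ∷ a ∷ []) ⟩
    d * b * b + (d * y) * a         ≡⟨ cong (λ z → d * b * b + z * a) dy≡ac+b ⟩
    d * b * b + (a * c + b) * a     ≡⟨ solve (a ∷ b ∷ c ∷ d ∷ []) ⟩
    b * (a + b * d) + c * (a * a)   ∎
  d[by+c] : d * (b * y + c) ≡ a * (b * c) + (b * b + c * d)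
  d[by+c] = begin
    d * (b * y + c)                 ≡⟨ solve (d ∷ b ∷ y ∷ c ∷ []) ⟩
    b * (d * y) + d * c             ≡⟨ cong (λ z → b * z + d * c) dy≡ac+b ⟩
    b * (a * c + b) + d * c         ≡⟨ solve (a ∷ b ∷ c ∷ d ∷ []) ⟩
    a * (b * c) + (b * b + c * d)   ∎
  k∣y⇒k∣ac+b : ∀ {k} → k ∣ y → k ∣ a * c + b
  k∣y⇒k∣ac+b {k} k∣y = subst (k ∣_) dy≡ac+b (∣n⇒∣m*n d k∣y)
  b⊥y : Coprime b y
  b⊥y (k∣b , k∣y) = coprime-* (Coprime.sym a⊥b) b⊥c (k∣b , ∣m+n∣n⇒∣m (k∣y⇒k∣ac+b k∣y) k∣b)
  c⊥y : Coprime c y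
  c⊥y (k∣c , k∣y) = Coprime.sym b⊥c (k∣c , ∣m+n∣m⇒∣n (k∣y⇒k∣ac+b k∣y) (∣n⇒∣m*n a k∣c))
  y⊥a : Coprime y a
  y⊥a (k∣y , k∣a) = a⊥b (k∣a , ∣m+n∣m⇒∣n (k∣y⇒k∣ac+b k∣y) (∣m⇒∣m*n c k∣a))

scale : ℕ → ℕ → ℕ → ℕ → ℕ → Q5
scale ε a b c d = (ι (ε * a) , ι (ε * b) , ι (ε * c) , ι (ε * d) , ι ε)

Admissible : ℕ → Q5 → Set
Admissible ε P = ∃[ a ] ∃[ b ] ∃[ c ] ∃[ d ] (Invariant a b c d × P ≡ scale ε a b c d)

ι-scaled-⊘ : ∀ {ε n k m} → 0 < ε → 0 < n → n * k ≡ m → ι (ε * ε * m) ⊘ ι (ε * n) ≡ ι (ε * k)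
ι-scaled-⊘ {ε} {n} {k} ε>0 n>0 n*k≡m = ι-⊘ (*-pos ε>0 n>0) (begin
  ε * ε * _       ≡⟨ cong (ε * ε *_) (sym n*k≡m) ⟩
  ε * ε * (n * k) ≡⟨ solve (ε ∷ n ∷ k ∷ []) ⟩
  ε * n * (ε * k) ∎)
  where open ≡-Reasoning

Admissible-α : ∀ {ε P} → 0 < ε → Admissible ε P → Admissible ε (α P)
Admissible-α {ε} ε>0 (a , b , c , d , I , refl) with Invariant.a∣b²+cd I
... | divides x b²+cd≡xa = b , x , c , d , Invariant-α I x ax≡b²+cd ,
  cong (λ z → (ι (ε * b) , z , ι (ε * c) , ι (ε * d) , ι ε)) (begin
    (ι (ε * b) ℚ.* ι (ε * b) ℚ.+ ι (ε * c) ℚ.* ι (ε * d)) ⊘ ι (ε * a)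
      ≡⟨ cong (_⊘ ι (ε * a)) (ι-sum-of-products (ε * b) (ε * b) (ε * c) (ε * d)) ⟩
    ι (ε * b * (ε * b) + ε * c * (ε * d)) ⊘ ι (ε * a)
      ≡⟨ cong (λ z → ι z ⊘ ι (ε * a)) numerator ⟩
    ι (ε * ε * (b * b + c * d)) ⊘ ι (ε * a)
      ≡⟨ ι-scaled-⊘ ε>0 (Invariant.a>0 I) ax≡b²+cd ⟩
    ι (ε * x) ∎)
  where
  open ≡-Reasoning
  ax≡b²+cd : a * x ≡ b * b + c * d
  ax≡b²+cd = trans (*-comm a x) (sym b²+cd≡xa)
  numerator : ε * b * (ε * b) + ε * c * (ε * d) ≡ ε * ε * (b * b + c * d)
  numerator = solve (ε ∷ b ∷ c ∷ d ∷ [])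

Admissible-β : ∀ {ε P} → 0 < ε → Admissible ε P → Admissible ε (β P)
Admissible-β {ε} ε>0 (a , b , c , d , I , refl) with Invariant.d∣ac+b I
... | divides y ac+b≡yd = b , c , y , a , Invariant-β I y dy≡ac+b ,
  cong (λ z → (ι (ε * b) , ι (ε * c) , z , ι (ε * a) , ι ε)) (begin
    (ι (ε * a) ℚ.* ι (ε * c) ℚ.+ ι (ε * b) ℚ.* ι ε) ⊘ ι (ε * d)
      ≡⟨ cong (_⊘ ι (ε * d)) (ι-sum-of-products (ε * a) (ε * c) (ε * b) ε) ⟩
    ι (ε * a * (ε * c) + ε * b * ε) ⊘ ι (ε * d)
      ≡⟨ cong (λ z → ι z ⊘ ι (ε * d)) numerator ⟩
    ι (ε * ε * (a * c + b)) ⊘ ι (ε * d)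
      ≡⟨ ι-scaled-⊘ ε>0 (Invariant.d>0 I) dy≡ac+b ⟩
    ι (ε * y) ∎)
  where
  open ≡-Reasoning
  dy≡ac+b : d * y ≡ a * c + b
  dy≡ac+b = trans (*-comm d y) (sym ac+b≡yd)
  numerator : ε * a * (ε * c) + ε * b * ε ≡ ε * ε * (a * c + b)
  numerator = solve (ε ∷ a ∷ b ∷ c ∷ [])

swap : Q5 → Q5
swap (a , b , c , d , e) = (b , a , d , c , e)

α⁻¹≡swap∘α∘swap : ∀ P → α⁻¹ P ≡ swap (α (swap P))
α⁻¹≡swap∘α∘swap (a , b , c , d , e) = cong (λ z → ((a ℚ.* a ℚ.+ z) ⊘ b , a , c , d , e)) (ℚ.*-comm c d)

β⁻¹≡swap∘β∘swap : ∀ P → β⁻¹ P ≡ swap (β (swap P))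
β⁻¹≡swap∘β∘swap (a , b , c , d , e) = cong (λ z → (d , a , b , z ⊘ c , e)) (ℚ.+-comm (a ℚ.* e) (b ℚ.* d))

Admissible-swap : ∀ {ε P} → Admissible ε P → Admissible ε (swap P)
Admissible-swap (a , b , c , d , I , refl) = b , a , d , c , Invariant-swap I , refl

Admissible-α⁻¹ : ∀ {ε P} → 0 < ε → Admissible ε P → Admissible ε (α⁻¹ P)
Admissible-α⁻¹ {ε} {P} ε>0 A =
  subst (Admissible ε) (sym (α⁻¹≡swap∘α∘swap P)) (Admissible-swap {ε} (Admissible-α ε>0 (Admissible-swap {ε} A)))

Admissible-β⁻¹ : ∀ {ε P} → 0 < ε → Admissible ε P → Admissible ε (β⁻¹ P)
Admissible-β⁻¹ {ε} {P} ε>0 A =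
  subst (Admissible ε) (sym (β⁻¹≡swap∘β∘swap P)) (Admissible-swap {ε} (Admissible-β ε>0 (Admissible-swap {ε} A)))

Admissible-gen : ∀ {ε P} → 0 < ε → ∀ g → Admissible ε P → Admissible ε (gen g P)
Admissible-gen ε>0 `α   = Admissible-α ε>0
Admissible-gen ε>0 `β   = Admissible-β ε>0
Admissible-gen ε>0 `α⁻¹ = Admissible-α⁻¹ ε>0
Admissible-gen ε>0 `β⁻¹ = Admissible-β⁻¹ ε>0

Admissible-diag : ∀ {ε} → Admissible ε (diag ε)
Admissible-diag {ε} = 1 , 1 , 1 , 1 , Invariant-1111 ,
  cong (λ z → (z , z , z , z , ι ε)) (cong ι (sym (*-identityʳ ε)))

Admissible-act : ∀ {ε} → 0 < ε → ∀ w → Admissible ε (act w (diag ε))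
Admissible-act {ε} ε>0 []  = Admissible-diag {ε}
Admissible-act ε>0 (g ∷ w) = Admissible-gen ε>0 g (Admissible-act ε>0 w)

proposition2p3 : (ε : ℕ) → 1 ≤ ε → (w : List Gen) →
    ∃[ a ] ∃[ b ] ∃[ c ] ∃[ d ]
      (act w (diag ε) ≡ (ι a , ι b , ι c , ι d , ι ε))
      × (1 ≤ a × 1 ≤ b × 1 ≤ c × 1 ≤ d)
      × (ε ∣ a × ε ∣ b × ε ∣ c × ε ∣ d × ε ∣ ε)
proposition2p3 ε ε>0 w with Admissible-act ε>0 w
... | a , b , c , d , I , act≡scale =
  ε * a , ε * b , ε * c , ε * d , act≡scale ,
  (*-pos ε>0 a>0 , *-pos ε>0 b>0 , *-pos ε>0 c>0 , *-pos ε>0 d>0) ,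
  (m∣m*n a , m∣m*n b , m∣m*n c , m∣m*n d , ∣-refl)
  where open Invariant I
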